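{- Let $c=(c_1,\dots,c_\ell)$ and $d=(d_1,\dots,d_{\ell-1})$ be vectors of positive integers. Then the number of acyclic orientations of the multi-fan $F(c,d)$ is \[ \alpha(F(c,d))=2\prod_{j=1}^{\ell-1}\left(2^{d_j+1}-1\right). \]
   Context: Multi-fans: for $\ell\ge1$ and positive integer vectors $c=(c_1,\dots,c_\ell)$, $d=(d_1,\dots,d_{\ell-1})$, $F(c,d)$ is the multigraph consisting of a path $v_1,v_1^2,\dots,v_1^{d_1},v_2,v_2^2,\dots,v_2^{d_2},\dots,v_{\ell-1},v_{\ell-1}^2,\dots,v_{\ell-1}^{d_{\ell-1}},v_\ell$ (so consecutive $v_i,v_{i+1}$ are joined by a path of $d_i$ edges) plus a vertex $x$ joined to each $v_i$ by a bundle of $c_i$ parallel edges; for $\ell=1$ it is a bundle of $c_1$ parallel edges (and the product is empty). An orientation is acyclic if it has no directed cycle; $\alpha(G)$ is the number of acyclic orientations of $G$. -}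

module Defs where

open import Data.Nat using (ℕ; zero; suc; _+_; _*_; _∸_; _^_; _<_)
open import Data.Bool using (Bool; true; false)
open import Data.Product using (_×_; _,_; proj₁; proj₂; ∃-syntax; Σ-syntax)
open import Data.List using (List; []; _∷_; _++_; length; map; upTo; replicate)
open import Data.Vec using (Vec; []; _∷_; lookup; fromList)
open import Data.Fin using (Fin; zero; suc; inject₁; fromℕ)
open import Data.List.Relation.Unary.Unique.Propositional using (Unique)
open import Data.List.Membership.Propositional using (_∈_)
open import Function.Bundles using (_⇔_)
open import Function.Definitions using (Injective)
open import Relation.Binary.PropositionalEquality using (_≡_)
open import Relation.Nullary using (¬_)

-- A (finite, loopless-or-not) multigraph given by its list of edges; vertices are
-- natural numbers (isolated vertices are irrelevant for acyclic orientations).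
-- Parallel edges are distinct list entries.
MultiGraph : Set
MultiGraph = List (ℕ × ℕ)

Edge : MultiGraph → Set
Edge G = Fin (length G)

endpoints : (G : MultiGraph) → Edge G → ℕ × ℕ
endpoints G e = lookup (fromList G) e

-- An orientation chooses a direction for every edge:
-- true orients edge (a , b) as a → b, false as b → a.
Orientation : MultiGraph → Set
Orientation G = Vec Bool (length G)

tail head : (G : MultiGraph) → Orientation G → Edge G → ℕ
tail G o e with lookup o e
... | true  = proj₁ (endpoints G e)
... | false = proj₂ (endpoints G e)
head G o e with lookup o e
... | true  = proj₂ (endpoints G e)
... | false = proj₁ (endpoints G e)

record DirectedCycle (G : MultiGraph) (o : Orientation G) : Set where
  field
    n     : ℕ
    u     : Fin (suc n) → ℕ
    e     : Fin (suc n) → Edge G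
    u-inj : Injective _≡_ _≡_ u
    e-inj : Injective _≡_ _≡_ e
    step-tail : (i : Fin (suc n)) → tail G o (e i) ≡ u i
    step-head : (i : Fin n) → head G o (e (inject₁ i)) ≡ u (suc i)
    close     : head G o (e (fromℕ n)) ≡ u zero

Acyclic : (G : MultiGraph) → Orientation G → Set
Acyclic G o = ¬ DirectedCycle G o

NumAcyclicOrientations : MultiGraph → ℕ → Set
NumAcyclicOrientations G N =
  ∃[ L ] (Unique L × (∀ (o : Orientation G) → (o ∈ L) ⇔ Acyclic G o) × length L ≡ N)

-- Multi-fan F(c,d), c of length suc k (= ℓ), d of length k.
-- Vertex x is 0; the path vertices are s, s+1, …, numbered consecutively from 1,
-- so v₁ = 1, and v_{i+1} = v_i + d_i.
pathEdges : ℕ → ℕ → List (ℕ × ℕ)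
pathEdges s d = map (λ i → (s + i , s + suc i)) (upTo d)

fanEdges : {k : ℕ} → ℕ → Vec ℕ (suc k) → Vec ℕ k → List (ℕ × ℕ)
fanEdges {zero}  s (c ∷ []) [] = replicate c (0 , s)
fanEdges {suc k} s (c ∷ cs) (d ∷ ds) = replicate c (0 , s) ++ (pathEdges s d ++ fanEdges (s + d) cs ds)

MultiFan : {k : ℕ} → Vec ℕ (suc k) → Vec ℕ k → MultiGraph
MultiFan c d = fanEdges 1 c d

prodTerm : {k : ℕ} → Vec ℕ k → ℕ
prodTerm [] = 1
prodTerm (d ∷ ds) = (2 ^ (d + 1) ∸ 1) * prodTerm ds

-- An acyclic orientation of F(c, d) directs each bundle x – v_i uniformly, say along b_i
-- (two opposite parallel edges form a 2-cycle), and then the only possible directed cycles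
-- are x → v_i → ⋯ → v_{i+1} → x. So the acyclic orientations are exactly those with uniform
-- bundles in which no segment between hubs with b_i ≠ b_{i+1} runs from the hub entered from x
-- to the hub leaving to x. Given b_i, the choices of b_{i+1} and of the segment orientation
-- number 2^{d_i} + (2^{d_i} − 1) = 2^{d_i + 1} − 1, and b_1 contributes the factor 2.
-- Acyclicity of these orientations is certified by integer heights: x at 0, each hub v_i on
-- the side of 0 given by b_i, and each segment fitted in between, from the last hub backwards.

module Submission where

open import Defs
open import Data.Bool using (Bool; true; false; not)
import Data.Bool.Properties as Boolₚ
open import Data.Empty using (⊥; ⊥-elim)
open import Data.Fin using (Fin; zero; suc; toℕ; inject₁; fromℕ)
import Data.Fin.Properties as Finₚ
open import Data.Integer as ℤ using (ℤ; +_; -[1+_]; +≤+; -≤+; -≤-; +<+; -<+)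
open import Data.Integer.Tactic.RingSolver using (solve-∀)
import Data.Integer.Properties as ℤₚ
open import Data.List using (List; []; _∷_; _++_; length; map; replicate; applyUpTo; cartesianProductWith)
import Data.List.Properties as Listₚ
open import Data.List.Membership.Propositional using (_∈_)
import Data.List.Membership.Propositional.Properties as ∈ₚ
open import Data.List.Relation.Unary.All as ListAll using ([]; _∷_)
import Data.List.Relation.Unary.All.Properties as ListAllₚ
open import Data.List.Relation.Unary.Any using (here)
open import Data.List.Relation.Unary.AllPairs using ([]; _∷_)
open import Data.List.Relation.Unary.Unique.Propositional using (Unique)
import Data.List.Relation.Unary.Unique.Propositional.Properties as Uniqueₚ
open import Data.Nat using (ℕ; zero; suc; _+_; _*_; _∸_; _^_; _≤_; _<_; _<?_; z≤n; s≤s)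
import Data.Nat.Properties as ℕₚ
open import Algebra.Properties.CommutativeSemigroup ℕₚ.+-commutativeSemigroup using (xy∙z≈xz∙y)
open import Data.Product using (_×_; _,_; proj₁; proj₂; Σ; ∃₂)
open import Data.Sum using (_⊎_; inj₁; inj₂)
open import Data.Unit using (⊤; tt)
open import Data.Vec using (Vec; []; _∷_; lookup)
import Data.Vec.Properties as Vecₚ
open import Data.Vec.Relation.Unary.All using (All; _∷_)
open import Function.Base using (_∘_)
open import Function.Bundles using (mk⇔)
open import Function.Definitions using (Injective)
open import Relation.Binary.PropositionalEquality
open import Relation.Nullary using (¬_; Dec; yes; no)

-- Arcs and height functions

source target : Bool → ℕ × ℕ → ℕ
source true  e = proj₁ e
source false e = proj₂ e
target true  e = proj₂ e
target false e = proj₁ e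

tail≡source : ∀ G o e → tail G o e ≡ source (lookup o e) (endpoints G e)
tail≡source G o e with lookup o e
... | true  = refl
... | false = refl

head≡target : ∀ G o e → head G o e ≡ target (lookup o e) (endpoints G e)
head≡target G o e with lookup o e
... | true  = refl
... | false = refl

Ascends : (ℕ → ℤ) → Bool → ℕ × ℕ → Set
Ascends h b e = h (source b e) ℤ.< h (target b e)

Respects : (ℕ → ℤ) → (G : MultiGraph) → Orientation G → Set
Respects h []      []      = ⊤
Respects h (e ∷ G) (b ∷ o) = Ascends h b e × Respects h G o

Respects⇒Ascends : ∀ {h} G o → Respects h G o → ∀ e → Ascends h (lookup o e) (endpoints G e)
Respects⇒Ascends (_ ∷ G) (_ ∷ o) (asc , _) zero    = asc
Respects⇒Ascends (_ ∷ G) (_ ∷ o) (_ , res) (suc e) = Respects⇒Ascends G o res e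

increasing⇒first≤last : ∀ n (f : Fin (suc n) → ℤ) →
  (∀ i → f (inject₁ i) ℤ.< f (suc i)) → f zero ℤ.≤ f (fromℕ n)
increasing⇒first≤last zero    f inc = ℤₚ.≤-refl
increasing⇒first≤last (suc n) f inc = ℤₚ.≤-trans
  (increasing⇒first≤last n (λ i → f (inject₁ i)) (λ i → inc (inject₁ i)))
  (ℤₚ.<⇒≤ (inc (fromℕ n)))

Respects⇒Acyclic : ∀ {h} G o → Respects h G o → Acyclic G o
Respects⇒Acyclic {h} G o res cyc =
  ℤₚ.<-irrefl refl (ℤₚ.≤-<-trans (increasing⇒first≤last n (h ∘ u) step) closing)
  where
  open DirectedCycle cyc
  ascends : ∀ e → h (tail G o e) ℤ.< h (head G o e)
  ascends e rewrite tail≡source G o e | head≡target G o e = Respects⇒Ascends G o res e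
  step : ∀ i → h (u (inject₁ i)) ℤ.< h (u (suc i))
  step i = subst₂ ℤ._<_ (cong h (step-tail (inject₁ i))) (cong h (step-head i))
    (ascends (e (inject₁ i)))
  closing : h (u (fromℕ n)) ℤ.< h (u zero)
  closing = subst₂ ℤ._<_ (cong h (step-tail (fromℕ n))) (cong h close) (ascends (e (fromℕ n)))

AllVertices : (ℕ → Set) → MultiGraph → Set
AllVertices Q = ListAll.All (λ e → Q (proj₁ e) × Q (proj₂ e))

Respects-cong : ∀ {Q h h'} G o → AllVertices Q G → (∀ v → Q v → h v ≡ h' v) →
  Respects h G o → Respects h' G o
Respects-cong                []      []      _          _  _           = tt
Respects-cong {h = h} {h'} (e ∷ G) (b ∷ o) (qe ∷ qG) eq (asc , res) =
  ascends b asc , Respects-cong G o qG eq res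
  where
  ascends : ∀ b → Ascends h b e → Ascends h' b e
  ascends true  = subst₂ ℤ._<_ (eq _ (proj₁ qe)) (eq _ (proj₂ qe))
  ascends false = subst₂ ℤ._<_ (eq _ (proj₂ qe)) (eq _ (proj₁ qe))

AllVertices-mono : ∀ {Q Q' : ℕ → Set} G → (∀ {v} → Q v → Q' v) →
  AllVertices Q G → AllVertices Q' G
AllVertices-mono G f = ListAll.map (λ q → f (proj₁ q) , f (proj₂ q))

-- Concatenation of graphs

appendᵒ : ∀ A {B} → Orientation A → Orientation B → Orientation (A ++ B)
appendᵒ []      []      r = r
appendᵒ (_ ∷ A) (b ∷ a) r = b ∷ appendᵒ A a r

splitᵒ : ∀ A {B} (o : Orientation (A ++ B)) → ∃₂ λ a r → o ≡ appendᵒ A {B} a r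
splitᵒ []      o       = [] , o , refl
splitᵒ (_ ∷ A) (b ∷ o) with splitᵒ A o
... | a , r , refl = b ∷ a , r , refl

appendᵒ-injective : ∀ A {B a a' r r'} →
  appendᵒ A {B} a r ≡ appendᵒ A a' r' → a ≡ a' × r ≡ r'
appendᵒ-injective []      {a = []}    {[]}     eq = refl , eq
appendᵒ-injective (_ ∷ A) {a = _ ∷ _} {_ ∷ _} eq with Vecₚ.∷-injective eq
... | refl , eq' with appendᵒ-injective A eq'
... | refl , refl = refl , refl

Respects-appendᵒ : ∀ {h} A {B} a r → Respects h A a → Respects h B r →
  Respects h (A ++ B) (appendᵒ A a r)
Respects-appendᵒ []      []      r _           resB = resB
Respects-appendᵒ (_ ∷ A) (_ ∷ a) r (asc , resA) resB = asc , Respects-appendᵒ A a r resA resB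

embedˡ : ∀ A B → Edge A → Edge (A ++ B)
embedˡ (_ ∷ A) B zero    = zero
embedˡ (_ ∷ A) B (suc i) = suc (embedˡ A B i)

embedʳ : ∀ A B → Edge B → Edge (A ++ B)
embedʳ []      B j = j
embedʳ (_ ∷ A) B j = suc (embedʳ A B j)

toℕ-embedˡ : ∀ A B i → toℕ (embedˡ A B i) ≡ toℕ i
toℕ-embedˡ (_ ∷ A) B zero    = refl
toℕ-embedˡ (_ ∷ A) B (suc i) = cong suc (toℕ-embedˡ A B i)

toℕ-embedʳ : ∀ A B j → toℕ (embedʳ A B j) ≡ length A + toℕ j
toℕ-embedʳ []      B j = refl
toℕ-embedʳ (_ ∷ A) B j = cong suc (toℕ-embedʳ A B j)

embedˡ-injective : ∀ A B → Injective _≡_ _≡_ (embedˡ A B)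
embedˡ-injective A B {i} {j} eq = Finₚ.toℕ-injective (begin
  toℕ i              ≡⟨ toℕ-embedˡ A B i ⟨
  toℕ (embedˡ A B i) ≡⟨ cong toℕ eq ⟩
  toℕ (embedˡ A B j) ≡⟨ toℕ-embedˡ A B j ⟩
  toℕ j              ∎)
  where open ≡-Reasoning

embedʳ-injective : ∀ A B → Injective _≡_ _≡_ (embedʳ A B)
embedʳ-injective A B {i} {j} eq = Finₚ.toℕ-injective (ℕₚ.+-cancelˡ-≡ (length A) _ _ (begin
  length A + toℕ i   ≡⟨ toℕ-embedʳ A B i ⟨
  toℕ (embedʳ A B i) ≡⟨ cong toℕ eq ⟩
  toℕ (embedʳ A B j) ≡⟨ toℕ-embedʳ A B j ⟩
  length A + toℕ j   ∎))
  where open ≡-Reasoning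

endpoints-embedˡ : ∀ A B i → endpoints (A ++ B) (embedˡ A B i) ≡ endpoints A i
endpoints-embedˡ (_ ∷ A) B zero    = refl
endpoints-embedˡ (_ ∷ A) B (suc i) = endpoints-embedˡ A B i

endpoints-embedʳ : ∀ A B j → endpoints (A ++ B) (embedʳ A B j) ≡ endpoints B j
endpoints-embedʳ []      B j = refl
endpoints-embedʳ (_ ∷ A) B j = endpoints-embedʳ A B j

lookup-embedˡ : ∀ A {B} a r i → lookup (appendᵒ A {B} a r) (embedˡ A B i) ≡ lookup a i
lookup-embedˡ (_ ∷ A) (_ ∷ a) r zero    = refl
lookup-embedˡ (_ ∷ A) (_ ∷ a) r (suc i) = lookup-embedˡ A a r i

lookup-embedʳ : ∀ A {B} a r j → lookup (appendᵒ A {B} a r) (embedʳ A B j) ≡ lookup r j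
lookup-embedʳ []      []      r j = refl
lookup-embedʳ (_ ∷ A) (_ ∷ a) r j = lookup-embedʳ A a r j

DirectedCycle-transport : ∀ G H o o' (f : Edge G → Edge H) → Injective _≡_ _≡_ f →
  (∀ e → lookup o' (f e) ≡ lookup o e) → (∀ e → endpoints H (f e) ≡ endpoints G e) →
  DirectedCycle G o → DirectedCycle H o'
DirectedCycle-transport G H o o' f f-inj lookup-f endpoints-f cyc = record
  { n = n ; u = u ; e = f ∘ e ; u-inj = u-inj ; e-inj = e-inj ∘ f-inj
  ; step-tail = λ i → trans (tail-f (e i)) (step-tail i)
  ; step-head = λ i → trans (head-f (e (inject₁ i))) (step-head i)
  ; close     = trans (head-f (e (fromℕ n))) close
  }
  where
  open DirectedCycle cyc
  tail-f : ∀ x → tail H o' (f x) ≡ tail G o x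
  tail-f x = trans (tail≡source H o' (f x))
    (trans (cong₂ source (lookup-f x) (endpoints-f x)) (sym (tail≡source G o x)))
  head-f : ∀ x → head H o' (f x) ≡ head G o x
  head-f x = trans (head≡target H o' (f x))
    (trans (cong₂ target (lookup-f x) (endpoints-f x)) (sym (head≡target G o x)))

DirectedCycle-++ˡ : ∀ A B a r → DirectedCycle A a → DirectedCycle (A ++ B) (appendᵒ A a r)
DirectedCycle-++ˡ A B a r = DirectedCycle-transport A (A ++ B) a (appendᵒ A a r)
  (embedˡ A B) (embedˡ-injective A B) (lookup-embedˡ A a r) (endpoints-embedˡ A B)

DirectedCycle-++ʳ : ∀ A B a r → DirectedCycle B r → DirectedCycle (A ++ B) (appendᵒ A a r)
DirectedCycle-++ʳ A B a r = DirectedCycle-transport B (A ++ B) r (appendᵒ A a r)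
  (embedʳ A B) (embedʳ-injective A B) (lookup-embedʳ A a r) (endpoints-embedʳ A B)

-- Directed cycles from closed walks

Arc : (G : MultiGraph) → Orientation G → Edge G → ℕ → ℕ → Set
Arc G o e x y = source (lookup o e) (endpoints G e) ≡ x × target (lookup o e) (endpoints G e) ≡ y

InjectiveUpTo : {A : Set} → ℕ → (ℕ → A) → Set
InjectiveUpTo n f = ∀ i j → i ≤ n → j ≤ n → f i ≡ f j → i ≡ j

closedWalk⇒DirectedCycle : ∀ G o n (f : ℕ → ℕ) (g : ℕ → Edge G) →
  InjectiveUpTo n f → InjectiveUpTo n g →
  (∀ k → k < n → Arc G o (g k) (f k) (f (suc k))) → Arc G o (g n) (f n) (f 0) →
  DirectedCycle G o
closedWalk⇒DirectedCycle G o n f g f-inj g-inj step last = record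
  { n = n ; u = f ∘ toℕ ; e = g ∘ toℕ
  ; u-inj = λ {i} {j} eq → Finₚ.toℕ-injective (f-inj _ _ (bound i) (bound j) eq)
  ; e-inj = λ {i} {j} eq → Finₚ.toℕ-injective (g-inj _ _ (bound i) (bound j) eq)
  ; step-tail = λ i → trans (tail≡source G o _) (source-g (toℕ i) (bound i))
  ; step-head = λ i → trans (head≡target G o _)
      (subst (λ k → target-g k ≡ f (suc (toℕ i))) (sym (Finₚ.toℕ-inject₁ i))
        (proj₂ (step _ (Finₚ.toℕ<n i))))
  ; close     = trans (head≡target G o _)
      (subst (λ k → target-g k ≡ f 0) (sym (Finₚ.toℕ-fromℕ n)) (proj₂ last))
  }
  where
  bound : (i : Fin (suc n)) → toℕ i ≤ n
  bound i = ℕₚ.≤-pred (Finₚ.toℕ<n i)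
  target-g : ℕ → ℕ
  target-g k = target (lookup o (g k)) (endpoints G (g k))
  source-g : ∀ k → k ≤ n → source (lookup o (g k)) (endpoints G (g k)) ≡ f k
  source-g k k≤n with ℕₚ.m≤n⇒m<n∨m≡n k≤n
  ... | inj₁ k<n  = proj₁ (step k k<n)
  ... | inj₂ refl = proj₁ last

reversedClosedWalk⇒DirectedCycle : ∀ G o n (f : ℕ → ℕ) (g : ℕ → Edge G) →
  InjectiveUpTo n f → InjectiveUpTo n g →
  (∀ k → k < n → Arc G o (g k) (f (suc k)) (f k)) → Arc G o (g n) (f 0) (f n) →
  DirectedCycle G o
reversedClosedWalk⇒DirectedCycle G o zero f g f-inj g-inj _ last =
  closedWalk⇒DirectedCycle G o zero f g f-inj g-inj (λ _ ()) last
-- Run the walk backwards from f 0: f 0, f n, f (n ∸ 1), …, f 1.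
reversedClosedWalk⇒DirectedCycle G o n@(suc m) f g f-inj g-inj step last =
  closedWalk⇒DirectedCycle G o n f' g' f'-inj g'-inj step' last'
  where
  f' : ℕ → ℕ
  f' zero    = f 0
  f' (suc j) = f (n ∸ j)
  g' : ℕ → Edge G
  g' j = g (n ∸ j)
  f'-inj : InjectiveUpTo n f'
  f'-inj zero    zero    _   _   _  = refl
  f'-inj zero    (suc j) _   j<n eq = ⊥-elim (ℕₚ.<⇒≢ (ℕₚ.m<n⇒0<n∸m j<n)
    (f-inj _ _ z≤n (ℕₚ.m∸n≤m n j) eq))
  f'-inj (suc i) zero    i<n _   eq = ⊥-elim (ℕₚ.<⇒≢ (ℕₚ.m<n⇒0<n∸m i<n)
    (f-inj _ _ z≤n (ℕₚ.m∸n≤m n i) (sym eq)))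
  f'-inj (suc i) (suc j) i<n j<n eq = cong suc (ℕₚ.∸-cancelˡ-≡ (ℕₚ.<⇒≤ i<n) (ℕₚ.<⇒≤ j<n)
    (f-inj _ _ (ℕₚ.m∸n≤m n i) (ℕₚ.m∸n≤m n j) eq))
  g'-inj : InjectiveUpTo n g'
  g'-inj i j i≤n j≤n eq =
    ℕₚ.∸-cancelˡ-≡ i≤n j≤n (g-inj _ _ (ℕₚ.m∸n≤m n i) (ℕₚ.m∸n≤m n j) eq)
  step' : ∀ k → k < n → Arc G o (g' k) (f' k) (f' (suc k))
  step' zero    _     = last
  step' (suc j) 1+j<n = subst (λ x → Arc G o (g (n ∸ suc j)) (f x) (f (n ∸ suc j)))
    (sym (ℕₚ.+-∸-assoc 1 j<n)) (step (n ∸ suc j) (ℕₚ.∸-monoʳ-< (s≤s z≤n) j<n))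
    where
    j<n : j < n
    j<n = ℕₚ.<⇒≤ 1+j<n
  last' : Arc G o (g' n) (f' n) (f' 0)
  last' = subst₂ (λ x y → Arc G o (g x) (f y) (f 0))
    (sym (ℕₚ.n∸n≡0 m)) (sym (ℕₚ.m+n∸n≡m 1 m)) (step 0 (s≤s z≤n))

ArcAlong : Bool → (G : MultiGraph) → Orientation G → Edge G → ℕ → ℕ → Set
ArcAlong true  G o e x y = Arc G o e x y
ArcAlong false G o e x y = Arc G o e y x

walkAlong⇒DirectedCycle : ∀ b G o n (f : ℕ → ℕ) (g : ℕ → Edge G) →
  InjectiveUpTo n f → InjectiveUpTo n g →
  (∀ k → k < n → ArcAlong b G o (g k) (f k) (f (suc k))) → ArcAlong b G o (g n) (f n) (f 0) →
  DirectedCycle G o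
walkAlong⇒DirectedCycle true  = closedWalk⇒DirectedCycle
walkAlong⇒DirectedCycle false = reversedClosedWalk⇒DirectedCycle

-- Counting orientations

constᵒ : (G : MultiGraph) → Bool → Orientation G
constᵒ []      b = []
constᵒ (_ ∷ G) b = b ∷ constᵒ G b

lookup-constᵒ : ∀ G b e → lookup (constᵒ G b) e ≡ b
lookup-constᵒ (_ ∷ G) b zero    = refl
lookup-constᵒ (_ ∷ G) b (suc e) = lookup-constᵒ G b e

branch : ∀ {n} b (X Y : List (Vec Bool n)) → List (Vec Bool (suc n))
branch b X Y = map (b ∷_) X ++ map (not b ∷_) Y

branch-unique : ∀ {n} b {X Y : List (Vec Bool n)} → Unique X → Unique Y → Unique (branch b X Y)
branch-unique b {X} {Y} uX uY =
  Uniqueₚ.++⁺ (Uniqueₚ.map⁺ Vecₚ.∷-injectiveʳ uX) (Uniqueₚ.map⁺ Vecₚ.∷-injectiveʳ uY)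
    disjoint
  where
  disjoint : ∀ {v} → ¬ (v ∈ map (b ∷_) X × v ∈ map (not b ∷_) Y)
  disjoint (p , q) with ∈ₚ.∈-map⁻ (b ∷_) p | ∈ₚ.∈-map⁻ (not b ∷_) q
  ... | _ , _ , refl | _ , _ , eq = Boolₚ.not-¬ refl (Vecₚ.∷-injectiveˡ eq)

length-branch : ∀ {n} b (X Y : List (Vec Bool n)) → length (branch b X Y) ≡ length X + length Y
length-branch b X Y = trans (Listₚ.length-++ (map (b ∷_) X))
  (cong₂ _+_ (Listₚ.length-map (b ∷_) X) (Listₚ.length-map (not b ∷_) Y))

orientations : (G : MultiGraph) → List (Orientation G)
orientations []      = [] ∷ []
orientations (_ ∷ G) = branch true (orientations G) (orientations G)

orientationsBut : Bool → (G : MultiGraph) → List (Orientation G)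
orientationsBut b []      = []
orientationsBut b (_ ∷ G) = branch b (orientationsBut b G) (orientations G)

∈-orientations : ∀ G o → o ∈ orientations G
∈-orientations []      []      = here refl
∈-orientations (_ ∷ G) (true  ∷ o) =
  ∈ₚ.∈-++⁺ˡ (∈ₚ.∈-map⁺ (true ∷_) (∈-orientations G o))
∈-orientations (_ ∷ G) (false ∷ o) =
  ∈ₚ.∈-++⁺ʳ _ (∈ₚ.∈-map⁺ (false ∷_) (∈-orientations G o))

∈-orientationsBut⁻ : ∀ b G {o} → o ∈ orientationsBut b G → o ≢ constᵒ G b
∈-orientationsBut⁻ b (_ ∷ G) o∈ eq with ∈ₚ.∈-++⁻ (map (b ∷_) (orientationsBut b G)) o∈
... | inj₁ o∈ˡ with ∈ₚ.∈-map⁻ (b ∷_) o∈ˡ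
...   | _ , o'∈ , refl = ∈-orientationsBut⁻ b G o'∈ (Vecₚ.∷-injectiveʳ eq)
∈-orientationsBut⁻ b (_ ∷ G) o∈ eq | inj₂ o∈ʳ with ∈ₚ.∈-map⁻ (not b ∷_) o∈ʳ
...   | _ , _ , refl = Boolₚ.not-¬ refl (sym (Vecₚ.∷-injectiveˡ eq))

∈-orientationsBut⁺ : ∀ b G o → o ≡ constᵒ G b ⊎ o ∈ orientationsBut b G
∈-orientationsBut⁺ b []      []      = inj₁ refl
∈-orientationsBut⁺ b (_ ∷ G) (c ∷ o) with c Boolₚ.≟ b
... | no c≢b = inj₂ (∈ₚ.∈-++⁺ʳ _ (∈-orientations′ (Boolₚ.¬-not c≢b)))
  where
  ∈-orientations′ : c ≡ not b → c ∷ o ∈ map (not b ∷_) (orientations G)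
  ∈-orientations′ refl = ∈ₚ.∈-map⁺ (c ∷_) (∈-orientations G o)
... | yes refl with ∈-orientationsBut⁺ b G o
...   | inj₁ refl = inj₁ refl
...   | inj₂ o∈   = inj₂ (∈ₚ.∈-++⁺ˡ (∈ₚ.∈-map⁺ (b ∷_) o∈))

orientations-unique : ∀ G → Unique (orientations G)
orientations-unique []      = [] ∷ []
orientations-unique (_ ∷ G) = branch-unique true (orientations-unique G) (orientations-unique G)

orientationsBut-unique : ∀ b G → Unique (orientationsBut b G)
orientationsBut-unique b []      = []
orientationsBut-unique b (_ ∷ G) = branch-unique b (orientationsBut-unique b G) (orientations-unique G)

length-orientations : ∀ G → length (orientations G) ≡ 2 ^ length G
length-orientations []      = refl
length-orientations (_ ∷ G) = begin
  length (branch true (orientations G) (orientations G))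
    ≡⟨ length-branch true (orientations G) _ ⟩
  length (orientations G) + length (orientations G)
    ≡⟨ cong (λ m → m + m) (length-orientations G) ⟩
  2 ^ length G + 2 ^ length G
    ≡⟨ cong (λ m → 2 ^ length G + m) (ℕₚ.+-identityʳ _) ⟨
  2 ^ suc (length G) ∎
  where open ≡-Reasoning

length-orientationsBut : ∀ b G → length (orientationsBut b G) + 1 ≡ 2 ^ length G
length-orientationsBut b []      = refl
length-orientationsBut b (_ ∷ G) = begin
  length (branch b (orientationsBut b G) (orientations G)) + 1
    ≡⟨ cong (_+ 1) (length-branch b (orientationsBut b G) _) ⟩
  length (orientationsBut b G) + length (orientations G) + 1
    ≡⟨ xy∙z≈xz∙y (length (orientationsBut b G)) _ 1 ⟩
  length (orientationsBut b G) + 1 + length (orientations G)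
    ≡⟨ cong₂ _+_ (length-orientationsBut b G) (length-orientations G) ⟩
  2 ^ length G + 2 ^ length G
    ≡⟨ cong (λ m → 2 ^ length G + m) (ℕₚ.+-identityʳ _) ⟨
  2 ^ suc (length G) ∎
  where open ≡-Reasoning

length-orientations+orientationsBut : ∀ b G →
  length (orientations G) + length (orientationsBut b G) ≡ 2 ^ (length G + 1) ∸ 1
length-orientations+orientationsBut b G = begin
  a + e             ≡⟨ ℕₚ.m+n∸n≡m (a + e) 1 ⟨
  a + e + 1 ∸ 1     ≡⟨ cong (_∸ 1) (ℕₚ.+-assoc a e 1) ⟩
  a + (e + 1) ∸ 1   ≡⟨ cong₂ (λ x y → x + y ∸ 1) (length-orientations G) (length-orientationsBut b G) ⟩
  2 ^ n + 2 ^ n ∸ 1 ≡⟨ cong (λ m → 2 ^ n + m ∸ 1) (ℕₚ.+-identityʳ _) ⟨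
  2 ^ suc n ∸ 1     ≡⟨ cong (λ m → 2 ^ m ∸ 1) (ℕₚ.+-comm 1 n) ⟩
  2 ^ (n + 1) ∸ 1   ∎
  where
  open ≡-Reasoning
  n a e : ℕ
  n = length G
  a = length (orientations G)
  e = length (orientationsBut b G)

-- Multi-fans and their acyclic orientations

path : ℕ → ℕ → MultiGraph
path s zero    = []
path s (suc d) = (s , suc s) ∷ path (suc s) d

length-path : ∀ s d → length (path s d) ≡ d
length-path s zero    = refl
length-path s (suc d) = cong suc (length-path (suc s) d)

bundle : ℕ → ℕ → MultiGraph
bundle c s = replicate c (0 , s)

fan : ∀ {k} → ℕ → Vec ℕ (suc k) → Vec ℕ k → MultiGraph
fan {zero} s (c ∷ [])  []       = bundle c s
fan {suc k} s (c ∷ cs) (d ∷ ds) = bundle c s ++ (path s d ++ fan (s + d) cs ds)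

applyUpTo-cong : ∀ {A : Set} {f g : ℕ → A} n → (∀ i → f i ≡ g i) →
  applyUpTo f n ≡ applyUpTo g n
applyUpTo-cong zero    f≗g = refl
applyUpTo-cong (suc n) f≗g = cong₂ _∷_ (f≗g 0) (applyUpTo-cong n (f≗g ∘ suc))

applyUpTo≡path : ∀ s d → applyUpTo (λ i → (s + i , s + suc i)) d ≡ path s d
applyUpTo≡path s zero    = refl
applyUpTo≡path s (suc d) = cong₂ _∷_
  (cong₂ _,_ (ℕₚ.+-identityʳ s) (ℕₚ.+-comm s 1))
  (trans (applyUpTo-cong d (λ i → cong₂ _,_ (ℕₚ.+-suc s i) (ℕₚ.+-suc s (suc i))))
         (applyUpTo≡path (suc s) d))

fanEdges≡fan : ∀ {k} s (c : Vec ℕ (suc k)) (d : Vec ℕ k) → fanEdges s c d ≡ fan s c d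
fanEdges≡fan {zero} s (c ∷ [])  []       = refl
fanEdges≡fan {suc k} s (c ∷ cs) (d ∷ ds) = cong (bundle c s ++_)
  (cong₂ _++_ (trans (Listₚ.map-upTo _ d) (applyUpTo≡path s d)) (fanEdges≡fan (s + d) cs ds))

constᵒ-true≡false⇒d≡0 : ∀ s d →
  constᵒ (path s d) true ≡ constᵒ (path s d) false → d ≡ 0
constᵒ-true≡false⇒d≡0 s zero    _  = refl
constᵒ-true≡false⇒d≡0 s (suc d) ()

-- When the bundles at the ends of a segment point x → v and w → x, orienting the whole
-- segment from v to w would close a directed cycle through x; that orientation is excluded.
segmentOrientations : Bool → Bool → (G : MultiGraph) → List (Orientation G)
segmentOrientations true  true  G = orientations G
segmentOrientations true  false G = orientationsBut true G
segmentOrientations false true  G = orientationsBut false G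
segmentOrientations false false G = orientations G

segmentOrientations-unique : ∀ b b' G → Unique (segmentOrientations b b' G)
segmentOrientations-unique true  true  G = orientations-unique G
segmentOrientations-unique true  false G = orientationsBut-unique true G
segmentOrientations-unique false true  G = orientationsBut-unique false G
segmentOrientations-unique false false G = orientations-unique G

length-segmentOrientations : ∀ b G →
  length (segmentOrientations b true G) + length (segmentOrientations b false G)
    ≡ 2 ^ (length G + 1) ∸ 1
length-segmentOrientations true  G = length-orientations+orientationsBut true G
length-segmentOrientations false G =
  trans (ℕₚ.+-comm (length (orientationsBut false G)) _) (length-orientations+orientationsBut false G)

glueᵒ : ∀ {R} c s d → Bool → Orientation (path s d) → Orientation R →
  Orientation (bundle c s ++ (path s d ++ R))
glueᵒ c s d b p r = appendᵒ (bundle c s) (constᵒ (bundle c s) b) (appendᵒ (path s d) p r)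

glueᵒ-injective : ∀ {R} c s d b {p p' r r'} →
  glueᵒ {R} c s d b p r ≡ glueᵒ c s d b p' r' → p ≡ p' × r ≡ r'
glueᵒ-injective c s d b eq =
  appendᵒ-injective (path s d) (proj₂ (appendᵒ-injective (bundle c s) eq))

gluings : ∀ c s d b b' R → List (Orientation R) →
  List (Orientation (bundle c s ++ (path s d ++ R)))
gluings c s d b b' R = cartesianProductWith (glueᵒ c s d b) (segmentOrientations b b' (path s d))

gluings-unique : ∀ c s d b b' R {rs : List (Orientation R)} →
  Unique rs → Unique (gluings c s d b b' R rs)
gluings-unique c s d b b' R = Uniqueₚ.cartesianProductWith⁺ (glueᵒ c s d b) (glueᵒ-injective c s d b)
  (segmentOrientations-unique b b' (path s d))

length-cartesianProductWith : ∀ {A B C : Set} (f : A → B → C) xs ys →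
  length (cartesianProductWith f xs ys) ≡ length xs * length ys
length-cartesianProductWith f []       ys = refl
length-cartesianProductWith f (x ∷ xs) ys = trans (Listₚ.length-++ (map (f x) ys))
  (cong₂ _+_ (Listₚ.length-map (f x) ys) (length-cartesianProductWith f xs ys))

length-gluings : ∀ c s d b b' R (rs : List (Orientation R)) →
  length (gluings c s d b b' R rs) ≡ length (segmentOrientations b b' (path s d)) * length rs
length-gluings c s d b b' R =
  length-cartesianProductWith (glueᵒ c s d b) (segmentOrientations b b' (path s d))

-- The acyclic orientations of fan s c d whose first bundle is directed along b.
fanOrientations : ∀ {k} s (c : Vec ℕ (suc k)) (d : Vec ℕ k) → Bool → List (Orientation (fan s c d))
fanOrientations {zero}  s (c ∷ [])  []       b = constᵒ (bundle c s) b ∷ []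
fanOrientations {suc k} s (c ∷ cs) (d ∷ ds) b =
  gluings c s d b true (fan (s + d) cs ds) (fanOrientations (s + d) cs ds true) ++
  gluings c s d b false (fan (s + d) cs ds) (fanOrientations (s + d) cs ds false)

∈-fanOrientations⁻ : ∀ {k} s c cs d (ds : Vec ℕ k) b {o} →
  o ∈ fanOrientations s (c ∷ cs) (d ∷ ds) b →
  Σ Bool λ b' → ∃₂ λ p r → p ∈ segmentOrientations b b' (path s d) ×
    r ∈ fanOrientations (s + d) cs ds b' × o ≡ glueᵒ c s d b p r
∈-fanOrientations⁻ s c cs d ds b o∈
  with ∈ₚ.∈-++⁻ (gluings c s d b true (fan (s + d) cs ds) (fanOrientations (s + d) cs ds true)) o∈
... | inj₁ o∈ᵗ =
  true  , ∈ₚ.∈-cartesianProductWith⁻ (glueᵒ c s d b) _ (fanOrientations (s + d) cs ds true)  o∈ᵗ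
... | inj₂ o∈ᶠ =
  false , ∈ₚ.∈-cartesianProductWith⁻ (glueᵒ c s d b) _ (fanOrientations (s + d) cs ds false) o∈ᶠ

∈-fanOrientations⁺ : ∀ {k} s c cs d (ds : Vec ℕ k) b b' {p r} →
  p ∈ segmentOrientations b b' (path s d) → r ∈ fanOrientations (s + d) cs ds b' →
  glueᵒ c s d b p r ∈ fanOrientations s (c ∷ cs) (d ∷ ds) b
∈-fanOrientations⁺ s c cs d ds b true  p∈ r∈ =
  ∈ₚ.∈-++⁺ˡ (∈ₚ.∈-cartesianProductWith⁺ (glueᵒ c s d b) p∈ r∈)
∈-fanOrientations⁺ s c cs d ds b false p∈ r∈ =
  ∈ₚ.∈-++⁺ʳ _ (∈ₚ.∈-cartesianProductWith⁺ (glueᵒ c s d b) p∈ r∈)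

firstEdge : ∀ {k} s c (cs : Vec ℕ k) ds → Edge (fan s (suc c ∷ cs) ds)
firstEdge s c []      []      = zero
firstEdge s c (_ ∷ _) (_ ∷ _) = zero

toℕ-firstEdge : ∀ {k} s c (cs : Vec ℕ k) ds → toℕ (firstEdge s c cs ds) ≡ 0
toℕ-firstEdge s c []      []      = refl
toℕ-firstEdge s c (_ ∷ _) (_ ∷ _) = refl

endpoints-firstEdge : ∀ {k} s c (cs : Vec ℕ k) ds →
  endpoints (fan s (suc c ∷ cs) ds) (firstEdge s c cs ds) ≡ (0 , s)
endpoints-firstEdge s c []      []      = refl
endpoints-firstEdge s c (_ ∷ _) (_ ∷ _) = refl

lookup-firstEdge : ∀ {k} s c (cs : Vec ℕ k) ds b {o} → o ∈ fanOrientations s (suc c ∷ cs) ds b →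
  lookup o (firstEdge s c cs ds) ≡ b
lookup-firstEdge s c []      []       b (here refl) = refl
lookup-firstEdge s c (_ ∷ _) (d ∷ ds) b o∈ with ∈-fanOrientations⁻ s (suc c) _ d ds b o∈
... | _ , _ , _ , _ , _ , refl = refl

fanOrientations-unique : ∀ {k} s (c : Vec ℕ (suc k)) d b → All (0 <_) c →
  Unique (fanOrientations s c d b)
fanOrientations-unique {zero}  s (c ∷ [])  []       b _ = [] ∷ []
fanOrientations-unique {suc k} s (c ∷ zero ∷ cs) (d ∷ ds) b (_ ∷ () ∷ _)
fanOrientations-unique {suc k} s (c ∷ cs@(suc c₁ ∷ cs′)) (d ∷ ds) b (_ ∷ c>0) =
  Uniqueₚ.++⁺ (X-unique true) (X-unique false) disjoint
  where
  X : Bool → List (Orientation (fan s (c ∷ cs) (d ∷ ds)))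
  X b' = gluings c s d b b' (fan (s + d) cs ds) (fanOrientations (s + d) cs ds b')
  X-unique : ∀ b' → Unique (X b')
  X-unique b' = gluings-unique c s d b b' _ (fanOrientations-unique (s + d) cs ds b' c>0)
  disjoint : ∀ {o} → ¬ (o ∈ X true × o ∈ X false)
  disjoint (o∈ᵗ , o∈ᶠ)
    with ∈ₚ.∈-cartesianProductWith⁻ (glueᵒ c s d b) (segmentOrientations b true (path s d)) _ o∈ᵗ
       | ∈ₚ.∈-cartesianProductWith⁻ (glueᵒ c s d b) (segmentOrientations b false (path s d)) _ o∈ᶠ
  ... | _ , _ , _ , r∈ᵗ , refl | _ , _ , _ , r∈ᶠ , eq with glueᵒ-injective c s d b eq
  ... | _ , refl = Boolₚ.not-¬ refl
    (trans (sym (lookup-firstEdge (s + d) c₁ cs′ ds true r∈ᵗ))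
           (lookup-firstEdge (s + d) c₁ cs′ ds false r∈ᶠ))

length-fanOrientations : ∀ {k} s (c : Vec ℕ (suc k)) d b →
  length (fanOrientations s c d b) ≡ prodTerm d
length-fanOrientations {zero}  s (c ∷ [])  []       b = refl
length-fanOrientations {suc k} s (c ∷ cs) (d ∷ ds) b = begin
  length (X true ++ X false)
    ≡⟨ Listₚ.length-++ (X true) ⟩
  length (X true) + length (X false)
    ≡⟨ cong₂ _+_ (length-X true) (length-X false) ⟩
  n true * prodTerm ds + n false * prodTerm ds
    ≡⟨ ℕₚ.*-distribʳ-+ (prodTerm ds) (n true) (n false) ⟨
  (n true + n false) * prodTerm ds
    ≡⟨ cong (_* prodTerm ds) (length-segmentOrientations b (path s d)) ⟩
  (2 ^ (length (path s d) + 1) ∸ 1) * prodTerm ds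
    ≡⟨ cong (λ m → (2 ^ (m + 1) ∸ 1) * prodTerm ds) (length-path s d) ⟩
  prodTerm (d ∷ ds) ∎
  where
  open ≡-Reasoning
  X : Bool → List (Orientation (fan s (c ∷ cs) (d ∷ ds)))
  X b' = gluings c s d b b' (fan (s + d) cs ds) (fanOrientations (s + d) cs ds b')
  n : Bool → ℕ
  n b' = length (segmentOrientations b b' (path s d))
  length-X : ∀ b' → length (X b') ≡ n b' * prodTerm ds
  length-X b' = trans (length-gluings c s d b b' _ (fanOrientations (s + d) cs ds b'))
    (cong (n b' *_) (length-fanOrientations (s + d) cs ds b'))

-- Heights for the listed orientations

i-j+j≡i : ∀ i j → (i ℤ.- j) ℤ.+ j ≡ i
i-j+j≡i = solve-∀

i+j-j≡i : ∀ i j → (i ℤ.+ j) ℤ.- j ≡ i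
i+j-j≡i = solve-∀

i<i+1 : ∀ i → i ℤ.< i ℤ.+ ℤ.1ℤ
i<i+1 i = ℤₚ.suc[i]≤j⇒i<j (ℤₚ.≤-reflexive (ℤₚ.+-comm ℤ.1ℤ i))

i-1<i : ∀ i → i ℤ.- ℤ.1ℤ ℤ.< i
i-1<i i = subst (λ j → i ℤ.- ℤ.1ℤ ℤ.< j) (i-j+j≡i i ℤ.1ℤ) (i<i+1 (i ℤ.- ℤ.1ℤ))

i+[1+n]≡[i+1]+n : ∀ i n → i ℤ.+ + suc n ≡ (i ℤ.+ ℤ.1ℤ) ℤ.+ + n
i+[1+n]≡[i+1]+n i n =
  trans (cong (λ j → i ℤ.+ j) (ℤₚ.pos-+ 1 n)) (sym (ℤₚ.+-assoc i ℤ.1ℤ (+ n)))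

i+[1+n]≡[i+n]+1 : ∀ i n → i ℤ.+ + suc n ≡ (i ℤ.+ + n) ℤ.+ ℤ.1ℤ
i+[1+n]≡[i+n]+1 i n =
  trans (cong (λ j → i ℤ.+ j) (trans (ℤₚ.pos-+ 1 n) (ℤₚ.+-comm ℤ.1ℤ (+ n))))
        (sym (ℤₚ.+-assoc i (+ n) ℤ.1ℤ))

-[1+m+n]+n≡-[1+m] : ∀ m n → -[1+ m + n ] ℤ.+ + n ≡ -[1+ m ]
-[1+m+n]+n≡-[1+m] m n =
  trans (cong (λ j → ℤ.- j ℤ.+ + n) (ℤₚ.pos-+ (suc m) n)) (-[i+j]+j≡-i (+ suc m) (+ n))
  where
  -[i+j]+j≡-i : ∀ i j → ℤ.- (i ℤ.+ j) ℤ.+ j ≡ ℤ.- i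
  -[i+j]+j≡-i = solve-∀

i≤j-k⇒i+k≤j : ∀ {i j} k → i ℤ.≤ j ℤ.- k → i ℤ.+ k ℤ.≤ j
i≤j-k⇒i+k≤j {i} {j} k i≤j-k =
  subst (λ l → i ℤ.+ k ℤ.≤ l) (i-j+j≡i j k) (ℤₚ.+-monoˡ-≤ k i≤j-k)

i+k≤j⇒i≤j-k : ∀ {i j} k → i ℤ.+ k ℤ.≤ j → i ℤ.≤ j ℤ.- k
i+k≤j⇒i≤j-k {i} {j} k i+k≤j =
  subst (λ l → l ℤ.≤ j ℤ.- k) (i+j-j≡i i k) (ℤₚ.+-monoˡ-≤ (ℤ.- k) i+k≤j)

Rises : Bool → ℤ → ℤ → Set
Rises true  A A' = A ℤ.< A'
Rises false A A' = A' ℤ.< A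

_[_≔_] : (ℕ → ℤ) → ℕ → ℤ → ℕ → ℤ
(h [ s ≔ A ]) v with v ℕₚ.≟ s
... | yes _ = A
... | no  _ = h v

[≔]-same : ∀ h s A → (h [ s ≔ A ]) s ≡ A
[≔]-same h s A with s ℕₚ.≟ s
... | yes _   = refl
... | no  s≢s = ⊥-elim (s≢s refl)

[≔]-other : ∀ h s A {v} → v ≢ s → (h [ s ≔ A ]) v ≡ h v
[≔]-other h s A {v} v≢s with v ℕₚ.≟ s
... | yes v≡s = ⊥-elim (v≢s v≡s)
... | no  _   = refl

AllVertices-path : ∀ s d → AllVertices (s ≤_) (path s d)
AllVertices-path s zero    = []
AllVertices-path s (suc d) = (ℕₚ.≤-refl , ℕₚ.n≤1+n s) ∷
  AllVertices-mono (path (suc s) d) (ℕₚ.≤-trans (ℕₚ.n≤1+n s)) (AllVertices-path (suc s) d)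

AllVertices-replicate : ∀ {Q : ℕ → Set} c {x y} → Q x → Q y → AllVertices Q (replicate c (x , y))
AllVertices-replicate zero    qx qy = []
AllVertices-replicate (suc c) qx qy = (qx , qy) ∷ AllVertices-replicate c qx qy

AllVertices-fan : ∀ {k} s (c : Vec ℕ (suc k)) d → AllVertices (λ v → v ≡ 0 ⊎ s ≤ v) (fan s c d)
AllVertices-fan {zero}  s (c ∷ [])  []       = AllVertices-replicate c (inj₁ refl) (inj₂ ℕₚ.≤-refl)
AllVertices-fan {suc k} s (c ∷ cs) (d ∷ ds) =
  ListAllₚ.++⁺ (AllVertices-replicate c (inj₁ refl) (inj₂ ℕₚ.≤-refl))
    (ListAllₚ.++⁺ (AllVertices-mono (path s d) inj₂ (AllVertices-path s d))
                  (AllVertices-mono (fan (s + d) cs ds) weaken (AllVertices-fan (s + d) cs ds)))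
  where
  weaken : ∀ {v} → v ≡ 0 ⊎ s + d ≤ v → v ≡ 0 ⊎ s ≤ v
  weaken (inj₁ v≡0)   = inj₁ v≡0
  weaken (inj₂ s+d≤v) = inj₂ (ℕₚ.≤-trans (ℕₚ.m≤m+n s d) s+d≤v)

Admissible : ∀ d s → Orientation (path s d) → ℤ → ℤ → Set
Admissible d s p A V = (p ≡ constᵒ (path s d) true  → A ℤ.+ + d ℤ.≤ V)
                     × (p ≡ constᵒ (path s d) false → V ℤ.+ + d ℤ.≤ A)

Admissible-step : ∀ d s b p A V → Admissible (suc d) s (b ∷ p) A V →
  Σ ℤ λ A' → Rises b A A' × Admissible d (suc s) p A' V
Admissible-step zero s true [] A V (fwd , _) =
  V , ℤₚ.<-≤-trans (i<i+1 A) (fwd refl) , V+0≤V , V+0≤V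
  where
  V+0≤V : ∀ {P : Set} → P → V ℤ.+ + 0 ℤ.≤ V
  V+0≤V _ = ℤₚ.≤-reflexive (ℤₚ.+-identityʳ V)
Admissible-step zero s false [] A V (_ , bwd) =
  V , ℤₚ.<-≤-trans (i<i+1 V) (bwd refl) , V+0≤V , V+0≤V
  where
  V+0≤V : ∀ {P : Set} → P → V ℤ.+ + 0 ℤ.≤ V
  V+0≤V _ = ℤₚ.≤-reflexive (ℤₚ.+-identityʳ V)
Admissible-step (suc d) s true p A V (fwd , _)
  with Vecₚ.≡-dec Boolₚ._≟_ p (constᵒ (path (suc s) (suc d)) false)
... | yes refl = (A ℤ.+ ℤ.1ℤ) ℤ.⊔ (V ℤ.+ + suc d) ,
  ℤₚ.<-≤-trans (i<i+1 A) (ℤₚ.i≤i⊔j _ _) , (λ ()) , (λ _ → ℤₚ.i≤j⊔i _ _)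
... | no p≢ = A ℤ.+ ℤ.1ℤ , i<i+1 A ,
  (λ { refl → subst (ℤ._≤ V) (i+[1+n]≡[i+1]+n A (suc d)) (fwd refl) }) , (λ p≡ → ⊥-elim (p≢ p≡))
Admissible-step (suc d) s false p A V (_ , bwd)
  with Vecₚ.≡-dec Boolₚ._≟_ p (constᵒ (path (suc s) (suc d)) true)
... | yes refl = (A ℤ.- ℤ.1ℤ) ℤ.⊓ (V ℤ.- + suc d) ,
  ℤₚ.≤-<-trans (ℤₚ.i⊓j≤i _ _) (i-1<i A) ,
  (λ _ → i≤j-k⇒i+k≤j (+ suc d) (ℤₚ.i⊓j≤j (A ℤ.- ℤ.1ℤ) _)) , (λ ())
... | no p≢ = A ℤ.- ℤ.1ℤ , i-1<i A , (λ p≡ → ⊥-elim (p≢ p≡)) ,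
  (λ { refl → i+k≤j⇒i≤j-k ℤ.1ℤ (subst (ℤ._≤ A) (i+[1+n]≡[i+n]+1 V (suc d)) (bwd refl)) })

pathHeights : ∀ d s p (A V : ℤ) (h : ℕ → ℤ) → h (s + d) ≡ V → Admissible d s p A V →
  Σ (ℕ → ℤ) λ h' → (∀ v → v < s ⊎ s + d ≤ v → h' v ≡ h v) × h' s ≡ A ×
    Respects h' (path s d) p
pathHeights zero s [] A V h h[s]≡V (fwd , bwd) = h , (λ _ _ → refl) , h[s]≡A , tt
  where
  h[s]≡A : h s ≡ A
  h[s]≡A = trans (cong h (sym (ℕₚ.+-identityʳ s))) (trans h[s]≡V (ℤₚ.≤-antisym
    (subst (ℤ._≤ A) (ℤₚ.+-identityʳ V) (bwd refl)) (subst (ℤ._≤ V) (ℤₚ.+-identityʳ A) (fwd refl))))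
pathHeights (suc d) s (b ∷ p) A V h h[s+d]≡V adm with Admissible-step d s b p A V adm
... | A' , rises , adm'
  with pathHeights d (suc s) p A' V h (trans (cong h (sym (ℕₚ.+-suc s d))) h[s+d]≡V) adm'
... | h₁ , agree₁ , h₁[1+s]≡A' , res₁ =
  h' , agree , [≔]-same h₁ s A , ascends b rises ,
  Respects-cong (path (suc s) d) p (AllVertices-path (suc s) d)
    (λ v s<v → sym ([≔]-other h₁ s A (ℕₚ.>⇒≢ s<v))) res₁
  where
  h' : ℕ → ℤ
  h' = h₁ [ s ≔ A ]
  h'[1+s]≡A' : h' (suc s) ≡ A'
  h'[1+s]≡A' = trans ([≔]-other h₁ s A ℕₚ.1+n≢n) h₁[1+s]≡A'
  ascends : ∀ b → Rises b A A' → Ascends h' b (s , suc s)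
  ascends true  A<A' = subst₂ ℤ._<_ (sym ([≔]-same h₁ s A)) (sym h'[1+s]≡A') A<A'
  ascends false A'<A = subst₂ ℤ._<_ (sym h'[1+s]≡A') (sym ([≔]-same h₁ s A)) A'<A
  agree : ∀ v → v < s ⊎ s + suc d ≤ v → h' v ≡ h v
  agree v (inj₁ v<s) =
    trans ([≔]-other h₁ s A (ℕₚ.<⇒≢ v<s)) (agree₁ v (inj₁ (ℕₚ.m<n⇒m<1+n v<s)))
  agree v (inj₂ s+d<v) =
    trans ([≔]-other h₁ s A (ℕₚ.>⇒≢ (ℕₚ.<-≤-trans (ℕₚ.m<m+n s (s≤s z≤n)) s+d<v)))
          (agree₁ v (inj₂ (subst (_≤ v) (ℕₚ.+-suc s d) s+d<v)))

Side : Bool → ℕ → ℤ → Set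
Side true  M z = + suc M ℤ.≤ z
Side false M z = z ℤ.≤ -[1+ M ]

sideValue : Bool → ℕ → ℤ
sideValue true  M = + suc M
sideValue false M = -[1+ M ]

Side-sideValue : ∀ b M → Side b M (sideValue b M)
Side-sideValue true  M = ℤₚ.≤-refl
Side-sideValue false M = ℤₚ.≤-refl

Side⇒Ascends : ∀ b M h s → h 0 ≡ + 0 → Side b M (h s) → Ascends h b (0 , s)
Side⇒Ascends true  M h s h[0]≡0 side =
  subst (ℤ._< h s) (sym h[0]≡0) (ℤₚ.<-≤-trans (+<+ (s≤s z≤n)) side)
Side⇒Ascends false M h s h[0]≡0 side =
  subst (h s ℤ.<_) (sym h[0]≡0) (ℤₚ.≤-<-trans side -<+)

Respects-constᵒ : ∀ {h} c e b → Ascends h b e →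
  Respects h (replicate c e) (constᵒ (replicate c e) b)
Respects-constᵒ zero    e b asc = tt
Respects-constᵒ (suc c) e b asc = asc , Respects-constᵒ c e b asc

-- The margin M + d at the far hub is what lets a forward segment of length d fit.
hubHeight : ∀ b b' M d s p V → p ∈ segmentOrientations b b' (path s d) → Side b' (M + d) V →
  Σ ℤ λ A → Side b M A × Admissible d s p A V
hubHeight true true M d s p V _ side with Vecₚ.≡-dec Boolₚ._≟_ p (constᵒ (path s d) false)
... | yes refl = V ℤ.+ + d ,
  ℤₚ.≤-trans (+≤+ (s≤s (ℕₚ.m≤m+n M d))) (ℤₚ.≤-trans side (ℤₚ.i≤i+j V (+ d))) ,
  (λ p≡ → fwd (constᵒ-true≡false⇒d≡0 s d (sym p≡))) , (λ _ → ℤₚ.≤-refl)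
  where
  fwd : d ≡ 0 → (V ℤ.+ + d) ℤ.+ + d ℤ.≤ V
  fwd refl = ℤₚ.≤-reflexive (trans (ℤₚ.+-identityʳ _) (ℤₚ.+-identityʳ V))
... | no p≢ = + suc M , ℤₚ.≤-refl ,
  (λ _ → subst (ℤ._≤ V) (ℤₚ.pos-+ (suc M) d) side) , (λ p≡ → ⊥-elim (p≢ p≡))
hubHeight true false M d s p V p∈ side = + suc M , ℤₚ.≤-refl ,
  (λ p≡ → ⊥-elim (∈-orientationsBut⁻ true (path s d) p∈ p≡)) ,
  (λ _ → ℤₚ.≤-trans (subst (V ℤ.+ + d ℤ.≤_) (-[1+m+n]+n≡-[1+m] M d) (ℤₚ.+-monoˡ-≤ (+ d) side))
                    -≤+)
hubHeight false false M d s p V _ side with Vecₚ.≡-dec Boolₚ._≟_ p (constᵒ (path s d) true)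
... | yes refl = V ℤ.- + d ,
  ℤₚ.≤-trans (ℤₚ.i-j≤i V (+ d)) (ℤₚ.≤-trans side (-≤- (ℕₚ.m≤m+n M d))) ,
  (λ _ → ℤₚ.≤-reflexive (i-j+j≡i V (+ d))) , (λ p≡ → bwd (constᵒ-true≡false⇒d≡0 s d p≡))
  where
  bwd : d ≡ 0 → V ℤ.+ + d ℤ.≤ V ℤ.- + d
  bwd refl = ℤₚ.≤-reflexive (trans (ℤₚ.+-identityʳ V) (sym (ℤₚ.+-identityʳ V)))
... | no p≢ = -[1+ M ] , ℤₚ.≤-refl , (λ p≡ → ⊥-elim (p≢ p≡)) ,
  (λ _ → subst (V ℤ.+ + d ℤ.≤_) (-[1+m+n]+n≡-[1+m] M d) (ℤₚ.+-monoˡ-≤ (+ d) side))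
hubHeight false true M d s p V p∈ side = -[1+ M ] , ℤₚ.≤-refl ,
  (λ _ → ℤₚ.≤-trans (ℤₚ.+-monoˡ-≤ (+ d) (-≤+ {m = M} {n = 0}))
                    (ℤₚ.≤-trans (+≤+ (ℕₚ.≤-trans (ℕₚ.m≤n+m d M) (ℕₚ.n≤1+n _))) side)) ,
  (λ p≡ → ⊥-elim (∈-orientationsBut⁻ false (path s d) p∈ p≡))

fanHeights : ∀ {k} s (c : Vec ℕ (suc k)) d b {o} → 0 < s → o ∈ fanOrientations s c d b → ∀ M →
  Σ (ℕ → ℤ) λ h → Respects h (fan s c d) o × h 0 ≡ + 0 × Side b M (h s)
fanHeights {zero} s (c ∷ []) [] b 0<s (here refl) M =
  h , Respects-constᵒ c (0 , s) b (Side⇒Ascends b M h s h[0]≡0 side) , h[0]≡0 , side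
  where
  h : ℕ → ℤ
  h = (λ _ → + 0) [ s ≔ sideValue b M ]
  h[0]≡0 : h 0 ≡ + 0
  h[0]≡0 = [≔]-other _ s _ (ℕₚ.<⇒≢ 0<s)
  side : Side b M (h s)
  side = subst (Side b M) (sym ([≔]-same _ s _)) (Side-sideValue b M)
fanHeights {suc k} s (c ∷ cs) (d ∷ ds) b 0<s o∈ M with ∈-fanOrientations⁻ s c cs d ds b o∈
... | b' , p , r , p∈ , r∈ , refl
  with fanHeights (s + d) cs ds b' (ℕₚ.<-≤-trans 0<s (ℕₚ.m≤m+n s d)) r∈ (M + d)
... | hᵣ , resᵣ , hᵣ[0]≡0 , sideᵣ with hubHeight b b' M d s p (hᵣ (s + d)) p∈ sideᵣ
... | A , sideA , adm with pathHeights d s p A (hᵣ (s + d)) hᵣ refl adm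
... | h , agree , h[s]≡A , resₚ =
  h , Respects-appendᵒ (bundle c s) _ _ resᵦ (Respects-appendᵒ (path s d) p r resₚ resᵣ′) ,
  h[0]≡0 , side
  where
  h[0]≡0 : h 0 ≡ + 0
  h[0]≡0 = trans (agree 0 (inj₁ 0<s)) hᵣ[0]≡0
  side : Side b M (h s)
  side = subst (Side b M) (sym h[s]≡A) sideA
  resᵦ : Respects h (bundle c s) (constᵒ (bundle c s) b)
  resᵦ = Respects-constᵒ c (0 , s) b (Side⇒Ascends b M h s h[0]≡0 side)
  agreeᵣ : ∀ v → v ≡ 0 ⊎ s + d ≤ v → hᵣ v ≡ h v
  agreeᵣ _ (inj₁ refl)  = sym (agree 0 (inj₁ 0<s))
  agreeᵣ v (inj₂ s+d≤v) = sym (agree v (inj₂ s+d≤v))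
  resᵣ′ : Respects h (fan (s + d) cs ds) r
  resᵣ′ = Respects-cong (fan (s + d) cs ds) r (AllVertices-fan (s + d) cs ds) agreeᵣ resᵣ

-- Directed cycles in the other orientations

endpoints-replicate : ∀ c x (e : Edge (replicate c x)) → endpoints (replicate c x) e ≡ x
endpoints-replicate (suc c) x zero    = refl
endpoints-replicate (suc c) x (suc e) = endpoints-replicate c x e

ArcAlong-intro : ∀ b G o e {x y} → lookup o e ≡ b → endpoints G e ≡ (x , y) →
  ArcAlong b G o e x y
ArcAlong-intro true  G o e o[e]≡b e≡xy rewrite o[e]≡b | e≡xy = refl , refl
ArcAlong-intro false G o e o[e]≡b e≡xy rewrite o[e]≡b | e≡xy = refl , refl

ArcAlong-not : ∀ b G o e {x y} → ArcAlong (not b) G o e x y → ArcAlong b G o e y x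
ArcAlong-not true  G o e arc = arc
ArcAlong-not false G o e arc = arc

InjectiveUpTo-1 : ∀ {A : Set} (f : ℕ → A) → f 0 ≢ f 1 → InjectiveUpTo 1 f
InjectiveUpTo-1 f f0≢f1 zero       zero       _         _         _  = refl
InjectiveUpTo-1 f f0≢f1 zero       (suc zero) _         _         eq = ⊥-elim (f0≢f1 eq)
InjectiveUpTo-1 f f0≢f1 (suc zero) zero       _         _         eq = ⊥-elim (f0≢f1 (sym eq))
InjectiveUpTo-1 f f0≢f1 (suc zero) (suc zero) _         _         _  = refl
InjectiveUpTo-1 f f0≢f1 (suc (suc _)) _       (s≤s ())  _         _
InjectiveUpTo-1 f f0≢f1 _       (suc (suc _)) _         (s≤s ())  _

antiparallel⇒DirectedCycle : ∀ b G o {e₁ e₂ x y} → x ≢ y → e₁ ≢ e₂ →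
  ArcAlong b G o e₁ x y → ArcAlong b G o e₂ y x → DirectedCycle G o
antiparallel⇒DirectedCycle b G o {e₁} {e₂} {x} {y} x≢y e₁≢e₂ arc₁ arc₂ =
  walkAlong⇒DirectedCycle b G o 1 f g (InjectiveUpTo-1 f x≢y) (InjectiveUpTo-1 g e₁≢e₂) step arc₂
  where
  f : ℕ → ℕ
  f zero    = x
  f (suc _) = y
  g : ℕ → Edge G
  g zero    = e₁
  g (suc _) = e₂
  step : ∀ k → k < 1 → ArcAlong b G o (g k) (f k) (f (suc k))
  step zero    _         = arc₁
  step (suc _) (s≤s ())

constᵒ⊎lookup≡not : ∀ G b o → o ≡ constᵒ G b ⊎ Σ (Edge G) λ e → lookup o e ≡ not b
constᵒ⊎lookup≡not []      b []      = inj₁ refl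
constᵒ⊎lookup≡not (_ ∷ G) b (c ∷ o) with c Boolₚ.≟ b
... | no c≢b   = inj₂ (zero , Boolₚ.¬-not c≢b)
... | yes refl with constᵒ⊎lookup≡not G b o
...   | inj₁ refl          = inj₁ refl
...   | inj₂ (e , o[e]≡¬b) = inj₂ (suc e , o[e]≡¬b)

constᵒ⊎DirectedCycle-bundle : ∀ c s → 0 < s → (a : Orientation (bundle (suc c) s)) →
  (Σ Bool λ b → a ≡ constᵒ (bundle (suc c) s) b) ⊎ DirectedCycle (bundle (suc c) s) a
constᵒ⊎DirectedCycle-bundle c s 0<s (b ∷ a) with constᵒ⊎lookup≡not (bundle c s) b a
... | inj₁ refl          = inj₁ (b , refl)
... | inj₂ (e , a[e]≡¬b) = inj₂ (antiparallel⇒DirectedCycle b (bundle (suc c) s) (b ∷ a)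
  (ℕₚ.<⇒≢ 0<s) (λ ()) (ArcAlong-intro b _ _ zero refl refl)
  (ArcAlong-not b _ _ (suc e) (ArcAlong-intro (not b) _ _ (suc e) a[e]≡¬b (endpoints-replicate c _ e))))

pathEdge : ∀ s d i → i < d → Edge (path s d)
pathEdge s (suc d) zero    _         = zero
pathEdge s (suc d) (suc i) (s≤s i<d) = suc (pathEdge (suc s) d i i<d)

toℕ-pathEdge : ∀ s d i i<d → toℕ (pathEdge s d i i<d) ≡ i
toℕ-pathEdge s (suc d) zero    _         = refl
toℕ-pathEdge s (suc d) (suc i) (s≤s i<d) = cong suc (toℕ-pathEdge (suc s) d i i<d)

endpoints-pathEdge : ∀ s d i i<d → endpoints (path s d) (pathEdge s d i i<d) ≡ (s + i , s + suc i)
endpoints-pathEdge s (suc d) zero    _         = cong₂ _,_ (sym (ℕₚ.+-identityʳ s)) (ℕₚ.+-comm 1 s)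
endpoints-pathEdge s (suc d) (suc i) (s≤s i<d) = trans (endpoints-pathEdge (suc s) d i i<d)
  (cong₂ _,_ (sym (ℕₚ.+-suc s i)) (sym (ℕₚ.+-suc s (suc i))))

-- The cycle x → s → s + 1 → ⋯ → s + d → x, traversed backwards when b = false.
closingCycle : ∀ {k} c s d c₁ (cs : Vec ℕ k) ds b r → 0 < s →
  lookup r (firstEdge (s + d) c₁ cs ds) ≡ not b →
  DirectedCycle (fan s (suc c ∷ suc c₁ ∷ cs) (d ∷ ds))
                (glueᵒ (suc c) s d b (constᵒ (path s d) b) r)
closingCycle c s d c₁ cs ds b r 0<s r[first]≡¬b =
  walkAlong⇒DirectedCycle b G o (suc d) f g f-inj g-inj step last
  where
  B P R G : MultiGraph
  B = bundle (suc c) s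
  P = path s d
  R = fan (s + d) (suc c₁ ∷ cs) ds
  G = B ++ (P ++ R)
  o : Orientation G
  o = glueᵒ (suc c) s d b (constᵒ P b) r
  first : Edge R
  first = firstEdge (s + d) c₁ cs ds

  f : ℕ → ℕ
  f zero    = 0
  f (suc i) = s + i

  segmentEdge : ∀ i → Dec (i < d) → Edge G
  segmentEdge i (yes i<d) = embedʳ B (P ++ R) (embedˡ P R (pathEdge s d i i<d))
  segmentEdge i (no _)    = embedʳ B (P ++ R) (embedʳ P R first)

  g : ℕ → Edge G
  g zero    = embedˡ B (P ++ R) zero
  g (suc i) = segmentEdge i (i <? d)

  f-inj : InjectiveUpTo (suc d) f
  f-inj zero    zero    _ _ _  = refl
  f-inj zero    (suc j) _ _ eq = ⊥-elim (ℕₚ.<⇒≢ (ℕₚ.<-≤-trans 0<s (ℕₚ.m≤m+n s j)) eq)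
  f-inj (suc i) zero    _ _ eq = ⊥-elim (ℕₚ.<⇒≢ (ℕₚ.<-≤-trans 0<s (ℕₚ.m≤m+n s i)) (sym eq))
  f-inj (suc i) (suc j) _ _ eq = cong suc (ℕₚ.+-cancelˡ-≡ s i j eq)

  index : ℕ → ℕ
  index zero    = 0
  index (suc i) = length B + i

  toℕ-g : ∀ k → k ≤ suc d → toℕ (g k) ≡ index k
  toℕ-g zero    _ = refl
  toℕ-g (suc i) (s≤s i≤d) with i <? d
  ... | yes i<d = trans (toℕ-embedʳ B (P ++ R) _)
    (cong (λ m → length B + m) (trans (toℕ-embedˡ P R _) (toℕ-pathEdge s d i i<d)))
  ... | no  i≮d = trans (toℕ-embedʳ B (P ++ R) _) (cong (λ m → length B + m) (begin
    toℕ (embedʳ P R first) ≡⟨ toℕ-embedʳ P R first ⟩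
    length P + toℕ first   ≡⟨ cong₂ _+_ (length-path s d) (toℕ-firstEdge (s + d) c₁ cs ds) ⟩
    d + 0                  ≡⟨ ℕₚ.+-identityʳ d ⟩
    d                      ≡⟨ ℕₚ.≤-antisym (ℕₚ.≮⇒≥ i≮d) i≤d ⟩
    i                      ∎))
    where open ≡-Reasoning

  index-injective : ∀ i j → index i ≡ index j → i ≡ j
  index-injective zero    zero    _  = refl
  index-injective (suc i) (suc j) eq = cong suc (ℕₚ.+-cancelˡ-≡ (length B) i j eq)

  g-inj : InjectiveUpTo (suc d) g
  g-inj i j i≤ j≤ eq =
    index-injective i j (trans (sym (toℕ-g i i≤)) (trans (cong toℕ eq) (toℕ-g j j≤)))

  step : ∀ k → k < suc d → ArcAlong b G o (g k) (f k) (f (suc k))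
  step zero    _         = ArcAlong-intro b G o _ refl (cong (0 ,_) (sym (ℕₚ.+-identityʳ s)))
  step (suc i) (s≤s i<d) with i <? d
  ... | yes i<d′ = ArcAlong-intro b G o _
    (trans (lookup-embedʳ B (constᵒ B b) _ _)
           (trans (lookup-embedˡ P (constᵒ P b) r _) (lookup-constᵒ P b _)))
    (trans (endpoints-embedʳ B (P ++ R) _)
           (trans (endpoints-embedˡ P R _) (endpoints-pathEdge s d i i<d′)))
  ... | no  i≮d  = ⊥-elim (i≮d i<d)

  last : ArcAlong b G o (g (suc d)) (f (suc d)) (f 0)
  last with d <? d
  ... | yes d<d = ⊥-elim (ℕₚ.<-irrefl refl d<d)
  ... | no  _   = ArcAlong-not b G o _ (ArcAlong-intro (not b) G o _
    (trans (lookup-embedʳ B (constᵒ B b) _ _)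
           (trans (lookup-embedʳ P (constᵒ P b) r _) r[first]≡¬b))
    (trans (endpoints-embedʳ B (P ++ R) _)
           (trans (endpoints-embedʳ P R first) (endpoints-firstEdge (s + d) c₁ cs ds))))

∈-segmentOrientations⊎constᵒ : ∀ b b' G p →
  p ∈ segmentOrientations b b' G ⊎ (b' ≡ not b × p ≡ constᵒ G b)
∈-segmentOrientations⊎constᵒ true  true  G p = inj₁ (∈-orientations G p)
∈-segmentOrientations⊎constᵒ false false G p = inj₁ (∈-orientations G p)
∈-segmentOrientations⊎constᵒ true  false G p with ∈-orientationsBut⁺ true G p
... | inj₁ p≡ = inj₂ (refl , p≡)
... | inj₂ p∈ = inj₁ p∈
∈-segmentOrientations⊎constᵒ false true  G p with ∈-orientationsBut⁺ false G p
... | inj₁ p≡ = inj₂ (refl , p≡)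
... | inj₂ p∈ = inj₁ p∈

∈-fanOrientations⊎DirectedCycle : ∀ {k} s (c : Vec ℕ (suc k)) d → 0 < s → All (0 <_) c → ∀ o →
  (Σ Bool λ b → o ∈ fanOrientations s c d b) ⊎ DirectedCycle (fan s c d) o
∈-fanOrientations⊎DirectedCycle {zero} s (zero ∷ []) [] _ (() ∷ _) o
∈-fanOrientations⊎DirectedCycle {zero} s (suc c ∷ []) [] 0<s _ o
  with constᵒ⊎DirectedCycle-bundle c s 0<s o
... | inj₁ (b , refl) = inj₁ (b , here refl)
... | inj₂ cyc        = inj₂ cyc
∈-fanOrientations⊎DirectedCycle {suc k} s (zero ∷ _) _ _ (() ∷ _) o
∈-fanOrientations⊎DirectedCycle {suc k} s (suc c ∷ zero ∷ _) _ _ (_ ∷ () ∷ _) o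
∈-fanOrientations⊎DirectedCycle {suc k} s (suc c ∷ suc c₁ ∷ cs) (d ∷ ds) 0<s (_ ∷ c>0) o
  with splitᵒ (bundle (suc c) s) o
... | a , q , refl with splitᵒ (path s d) q
... | p , r , refl with constᵒ⊎DirectedCycle-bundle c s 0<s a
... | inj₂ cyc = inj₂ (DirectedCycle-++ˡ B (P ++ R) a (appendᵒ P p r) cyc)
  where B = bundle (suc c) s ; P = path s d ; R = fan (s + d) (suc c₁ ∷ cs) ds
... | inj₁ (b , refl)
  with ∈-fanOrientations⊎DirectedCycle (s + d) (suc c₁ ∷ cs) ds (ℕₚ.<-≤-trans 0<s (ℕₚ.m≤m+n s d)) c>0 r
... | inj₂ cyc =
  inj₂ (DirectedCycle-++ʳ B (P ++ R) (constᵒ B b) (appendᵒ P p r) (DirectedCycle-++ʳ P R p r cyc))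
  where B = bundle (suc c) s ; P = path s d ; R = fan (s + d) (suc c₁ ∷ cs) ds
... | inj₁ (b' , r∈) with ∈-segmentOrientations⊎constᵒ b b' (path s d) p
... | inj₁ p∈ = inj₁ (b , ∈-fanOrientations⁺ s (suc c) (suc c₁ ∷ cs) d ds b b' p∈ r∈)
... | inj₂ (refl , refl) =
  inj₂ (closingCycle c s d c₁ cs ds b r 0<s (lookup-firstEdge (s + d) c₁ cs ds (not b) r∈))

∈-fanOrientations⇒Acyclic : ∀ {k} s (c : Vec ℕ (suc k)) d b {o} → 0 < s →
  o ∈ fanOrientations s c d b → Acyclic (fan s c d) o
∈-fanOrientations⇒Acyclic s c d b {o} 0<s o∈ with fanHeights s c d b 0<s o∈ 0
... | _ , res , _ = Respects⇒Acyclic (fan s c d) o res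

NumAcyclicOrientations-fan : ∀ {k} (c : Vec ℕ (suc k)) d → All (0 <_) c →
  NumAcyclicOrientations (fan 1 c d) (2 * prodTerm d)
NumAcyclicOrientations-fan (zero ∷ _) d (() ∷ _)
NumAcyclicOrientations-fan c@(suc c₀ ∷ cs) d c>0 =
  L true ++ L false , unique , (λ o → mk⇔ (sound o) (complete o)) , len
  where
  L : Bool → List (Orientation (fan 1 c d))
  L = fanOrientations 1 c d
  unique : Unique (L true ++ L false)
  unique = Uniqueₚ.++⁺ (fanOrientations-unique 1 c d true c>0) (fanOrientations-unique 1 c d false c>0)
    λ (o∈ᵗ , o∈ᶠ) → Boolₚ.not-¬ refl
      (trans (sym (lookup-firstEdge 1 c₀ cs d true o∈ᵗ)) (lookup-firstEdge 1 c₀ cs d false o∈ᶠ))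
  sound : ∀ o → o ∈ L true ++ L false → Acyclic (fan 1 c d) o
  sound o o∈ with ∈ₚ.∈-++⁻ (L true) o∈
  ... | inj₁ o∈ᵗ = ∈-fanOrientations⇒Acyclic 1 c d true  (s≤s z≤n) o∈ᵗ
  ... | inj₂ o∈ᶠ = ∈-fanOrientations⇒Acyclic 1 c d false (s≤s z≤n) o∈ᶠ
  complete : ∀ o → Acyclic (fan 1 c d) o → o ∈ L true ++ L false
  complete o acyclic with ∈-fanOrientations⊎DirectedCycle 1 c d (s≤s z≤n) c>0 o
  ... | inj₁ (true  , o∈) = ∈ₚ.∈-++⁺ˡ o∈
  ... | inj₁ (false , o∈) = ∈ₚ.∈-++⁺ʳ (L true) o∈
  ... | inj₂ cyc          = ⊥-elim (acyclic cyc)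
  len : length (L true ++ L false) ≡ 2 * prodTerm d
  len = trans (Listₚ.length-++ (L true))
    (trans (cong₂ _+_ (length-fanOrientations 1 c d true) (length-fanOrientations 1 c d false))
           (cong (λ m → prodTerm d + m) (sym (ℕₚ.+-identityʳ (prodTerm d)))))

lemma3p4 : (k : ℕ) (c : Vec ℕ (suc k)) (d : Vec ℕ k) →
    All (0 <_) c → All (0 <_) d →
    NumAcyclicOrientations (MultiFan c d) (2 * prodTerm d)
lemma3p4 k c d c>0 _ = subst (λ G → NumAcyclicOrientations G (2 * prodTerm d))
  (sym (fanEdges≡fan 1 c d)) (NumAcyclicOrientations-fan c d c>0)
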